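{- Let $(L,\preceq)$ be a lattice, $\delta$ a local congruence on $L$, and $[x]_\delta,[y]_\delta\in L/\delta$ with $[x]_\delta\preceq_\delta[y]_\delta$ and $[y]_\delta\preceq_\delta[x]_\delta$. If there are $x_1,x_2\in[x]_\delta$ and $y_1,y_2\in[y]_\delta$ with $x_1\preceq y_1$ and $y_2\preceq x_2$, then $[x]_\delta=[y]_\delta$.
   Context: A local congruence on a lattice $(L,\preceq)$ is an equivalence relation $\delta$ on $L$ each of whose equivalence classes is a sublattice of $L$ and is convex (if $u,v$ are in a class and $u\preceq w\preceq v$, then $w$ is in that class). $[a]_\delta$ denotes the class of $a$ and $L/\delta$ the set of classes. A $\delta$-sequence from $p_0$ to $p_n$ is a finite sequence $(p_0,p_1,\dots,p_n)$, $n\ge1$, of elements of $L$ such that for each $i\in\{1,\dots,n\}$ either $(p_{i-1},p_i)\in\delta$ or $p_{i-1}\preceq p_i$. The relation $\preceq_\delta$ on $L/\delta$ is defined by $[x]_\delta\preceq_\delta[y]_\delta$ iff there exist $x'\in[x]_\delta$, $y'\in[y]_\delta$ and a $\delta$-sequence from $x'$ to $y'$. -}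

module Defs where

open import Level using (Level; _⊔_; suc)
open import Data.Product using (_×_; Σ-syntax)
open import Relation.Binary.Core using (Rel)
open import Relation.Binary.Definitions using (_Respects₂_)
open import Relation.Binary.Structures using (IsEquivalence)
open import Relation.Binary.Lattice using (Lattice)

module _ {c ℓ₁ ℓ₂ : Level} (L : Lattice c ℓ₁ ℓ₂) where
  open Lattice L

  -- A local congruence: an equivalence relation δ on L (compatible with the
  -- setoid equality ≈ of L) each of whose classes is a sublattice and convex.
  -- The class of a is { w ∣ δ a w }.
  record IsLocalCongruence {ℓ : Level} (δ : Rel Carrier ℓ) : Set (c ⊔ ℓ₁ ⊔ ℓ₂ ⊔ ℓ) where
    field
      isEquivalence : IsEquivalence δ
      respects-≈    : δ Respects₂ _≈_
      class-∨ : ∀ {a u v} → δ a u → δ a v → δ a (u ∨ v)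
      class-∧ : ∀ {a u v} → δ a u → δ a v → δ a (u ∧ v)
      class-convex : ∀ {a u v w} → δ a u → δ a v → u ≤ w → w ≤ v → δ a w

  data δ-Step {ℓ : Level} (δ : Rel Carrier ℓ) (p q : Carrier) : Set (ℓ ⊔ ℓ₂) where
    δ-step : δ p q → δ-Step δ p q
    ≤-step : p ≤ q → δ-Step δ p q

  data δ-Sequence {ℓ : Level} (δ : Rel Carrier ℓ) : Carrier → Carrier → Set (c ⊔ ℓ ⊔ ℓ₂) where
    [_]  : ∀ {p q} → δ-Step δ p q → δ-Sequence δ p q
    _∷_  : ∀ {p q r} → δ-Step δ p q → δ-Sequence δ q r → δ-Sequence δ p r

  _⪯[_]_ : {ℓ : Level} → Carrier → Rel Carrier ℓ → Carrier → Set (c ⊔ ℓ ⊔ ℓ₂)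
  x ⪯[ δ ] y = Σ[ x′ ∈ Carrier ] Σ[ y′ ∈ Carrier ] (δ x x′ × δ y y′ × δ-Sequence δ x′ y′)

{-# OPTIONS --safe #-}
-- If x₁ ≤ y₁ and y₂ ≤ x₂, the element x₂ ∧ y₁ lies in both classes: it is
-- squeezed between x₁ ∧ x₂ and x₂ in [x], and between y₁ ∧ y₂ and y₁ in [y].
-- Convexity and closure under ∧ therefore make the classes meet.
module Submission where

open import Defs
open import Level using (Level)
open import Data.Product using (_×_; _,_; proj₁)
open import Relation.Binary.Core using (Rel)
open import Relation.Binary.Lattice using (Lattice)
open import Relation.Binary.Structures using (IsEquivalence)
import Relation.Binary.Lattice.Properties.MeetSemilattice as MeetProperties

module LocalCongruence {c ℓ₁ ℓ₂ ℓ : Level} (L : Lattice c ℓ₁ ℓ₂) {δ : Rel (Lattice.Carrier L) ℓ}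
                       (isLocalCongruence : IsLocalCongruence L δ) where
  open Lattice L
  open IsLocalCongruence isLocalCongruence hiding (isEquivalence)
  open IsEquivalence (IsLocalCongruence.isEquivalence isLocalCongruence)
    using () renaming (sym to δ-sym; trans to δ-trans)
  open MeetProperties meetSemilattice using (∧-comm)

  class-∧-upperBound : ∀ {a u v w} → δ a u → δ a v → u ≤ w → δ a (v ∧ w)
  class-∧-upperBound {u = u} {v} {w} δau δav u≤w =
    class-convex (class-∧ δau δav) δav u∧v≤v∧w (x∧y≤x v w)
    where
    u∧v≤v∧w : u ∧ v ≤ v ∧ w
    u∧v≤v∧w = ∧-greatest (x∧y≤y u v) (trans (x∧y≤x u v) u≤w)

  classes-meet : ∀ {x y x₁ x₂ y₁ y₂} → δ x x₁ → δ x x₂ → δ y y₁ → δ y y₂ →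
                 x₁ ≤ y₁ → y₂ ≤ x₂ → δ x (x₂ ∧ y₁) × δ y (x₂ ∧ y₁)
  classes-meet δxx₁ δxx₂ δyy₁ δyy₂ x₁≤y₁ y₂≤x₂ =
    class-∧-upperBound δxx₁ δxx₂ x₁≤y₁ ,
    proj₁ respects-≈ (∧-comm _ _) (class-∧-upperBound δyy₂ δyy₁ y₂≤x₂)

  common-member⇒δ : ∀ {x y z} → δ x z → δ y z → δ x y
  common-member⇒δ δxz δyz = δ-trans δxz (δ-sym δyz)

corollary23 : {c ℓ₁ ℓ₂ ℓ : Level} (L : Lattice c ℓ₁ ℓ₂) (δ : Rel (Lattice.Carrier L) ℓ)
    → IsLocalCongruence L δ
    → (x y : Lattice.Carrier L)
    → _⪯[_]_ L x δ y → _⪯[_]_ L y δ x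
    → (x₁ x₂ y₁ y₂ : Lattice.Carrier L)
    → δ x x₁ → δ x x₂ → δ y y₁ → δ y y₂
    → Lattice._≤_ L x₁ y₁ → Lattice._≤_ L y₂ x₂
    → δ x y
corollary23 L δ lc x y _ _ x₁ x₂ y₁ y₂ δxx₁ δxx₂ δyy₁ δyy₂ x₁≤y₁ y₂≤x₂ =
  let open LocalCongruence L lc
      (δxz , δyz) = classes-meet δxx₁ δxx₂ δyy₁ δyy₂ x₁≤y₁ y₂≤x₂
  in  common-member⇒δ δxz δyz
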